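{- Let $\varrho\geq 2$ and $\ell\geq 1$ be integers. For every $z\in\mathbb N$ with $\varrho^{\ell-1}\leq z\leq\varrho^\ell-2$ there are $x,y,z'\in\{0,1,\dots,\varrho^\ell-1\}$ such that $xy=\varrho^\ell z+z'$. -}

module Defs where

{-# OPTIONS --safe #-}
-- With N = ρ ^ ℓ, the identity (N − 1)(z + 1) = N z + (N − 1 − z) exhibits the
-- required product for every z ≤ N − 2: take x = N − 1 and y = z + 1.  The lower
-- bound ρ ^ (ℓ − 1) ≤ z only serves to make z positive, which rules out N < 2.
module Submission where

open import Defs
open import Data.Nat using (ℕ; suc; _+_; _*_; _∸_; _^_; _≤_; _<_; s≤s)
open import Data.Nat.Properties using (m^n>0; ≤-trans; ≤-refl; m≤m+n; m≤n+m; m≤n⇒∃[o]m+o≡n)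
open import Data.Nat.Tactic.RingSolver using (solve-∀)
open import Data.Product using (∃-syntax; _×_; _,_)
open import Relation.Binary.PropositionalEquality using (_≡_; refl)

-- The identity above with N written as z + k + 2, so that no subtraction occurs.
pred-mul-suc≡mul+rest : ∀ z k → suc (z + k) * suc z ≡ suc (suc (z + k)) * z + suc k
pred-mul-suc≡mul+rest = solve-∀

digit-product-with-quotient : ∀ N z → suc z < N →
  ∃[ x ] ∃[ y ] ∃[ z′ ] (x < N × y < N × z′ < N × x * y ≡ N * z + z′)
digit-product-with-quotient N z 2+z≤N with m≤n⇒∃[o]m+o≡n 2+z≤N
... | k , refl =
  suc (z + k) , suc z , suc k ,
  ≤-refl , s≤s (s≤s (m≤m+n z k)) , s≤s (s≤s (m≤n+m k z)) ,
  pred-mul-suc≡mul+rest z k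

0<m≤n∸2⇒1+m<n : ∀ {m n} → 0 < m → m ≤ n ∸ 2 → 1 + m < n
0<m≤n∸2⇒1+m<n {n = suc (suc n)} _ m≤n = s≤s (s≤s m≤n)
0<m≤n∸2⇒1+m<n {n = 0}           (s≤s _) ()
0<m≤n∸2⇒1+m<n {n = 1}           (s≤s _) ()

lemma5p1 : (ρ ℓ : ℕ) → 2 ≤ ρ → 1 ≤ ℓ → (z : ℕ) →
           ρ ^ (ℓ ∸ 1) ≤ z → z ≤ ρ ^ ℓ ∸ 2 →
           ∃[ x ] ∃[ y ] ∃[ z′ ] (x < ρ ^ ℓ × y < ρ ^ ℓ × z′ < ρ ^ ℓ × x * y ≡ ρ ^ ℓ * z + z′)
lemma5p1 ρ@(suc _) ℓ _ _ z ρ^[ℓ∸1]≤z z≤ρ^ℓ∸2 =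
  digit-product-with-quotient (ρ ^ ℓ) z (0<m≤n∸2⇒1+m<n 0<z z≤ρ^ℓ∸2)
  where
  0<z : 0 < z
  0<z = ≤-trans (m^n>0 ρ (ℓ ∸ 1)) ρ^[ℓ∸1]≤z
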